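{- For each integer $a\geqslant 2$, $$\zeta(a)=2\sum_{b=3}^{a}\sigma(b,\underbrace{1,\ldots,1}_{a-b})+3\,\sigma(2,\underbrace{1,\ldots,1}_{a-2}),$$ where $\zeta(a)=\sum_{n\geqslant1}n^{ -a}$.
   Context: For a composition (finite sequence of positive integers) $\mathbf{a}=(a_1,\ldots,a_r)$ with $r\geqslant1$, $\sigma(\mathbf{a})=\sum_{n_1>n_2>\cdots>n_r>0}\binom{2n_1}{n_1}^{ -1}n_1^{ -a_1}\cdots n_r^{ -a_r}$. -}

module Defs where

open import Data.Nat using (ℕ; zero; suc; _^_; _∸_) renaming (_*_ to _*ℕ_; _+_ to _+ℕ_)
open import Data.Nat.Combinatorics using (_C_)
open import Data.Integer using (+_)
open import Data.Rational using (ℚ; 0ℚ; 1ℚ; _+_; _*_; _/_)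
open import Data.List using (List; []; _∷_; replicate)

-- inv n = 1/n for n ≥ 1 (inv 0 = 0 is a junk value never used below)
inv : ℕ → ℚ
inv zero    = 0ℚ
inv (suc k) = (+ 1) / suc k

sum1 : ℕ → (ℕ → ℚ) → ℚ
sum1 zero    f = 0ℚ
sum1 (suc N) f = sum1 N f + f (suc N)

sumRange : ℕ → ℕ → (ℕ → ℚ) → ℚ
sumRange lo hi f = go (suc hi ∸ lo)
  where
  go : ℕ → ℚ
  go zero    = 0ℚ
  go (suc k) = go k + f (lo +ℕ k)

-- tail m (a₂,…,a_r) = Σ_{m > n₂ > ⋯ > n_r > 0} n₂^{-a₂} ⋯ n_r^{-a_r}
tailSum : List ℕ → ℕ → ℚ
tailSum []       m = 1ℚ
tailSum (a ∷ as) m = sum1 (m ∸ 1) (λ n → inv (n ^ a) * tailSum as n)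

-- truncated σ: σ_N(a₁,…,a_r) = Σ_{N ≥ n₁ > ⋯ > n_r > 0} C(2n₁,n₁)^{-1} n₁^{-a₁} ⋯ n_r^{-a_r}
σN : List ℕ → ℕ → ℚ
σN []       N = 0ℚ
σN (a ∷ as) N = sum1 N (λ n → inv ((2 *ℕ n) C n) * inv (n ^ a) * tailSum as n)

ζN : ℕ → ℕ → ℚ
ζN a N = sum1 N (λ n → inv (n ^ a))

comp : ℕ → ℕ → List ℕ
comp b k = b ∷ replicate k 1

rhsN : ℕ → ℕ → ℚ
rhsN a N = (+ 2 / 1) * sumRange 3 a (λ b → σN (comp b (a ∸ b)) N)
         + (+ 3 / 1) * σN (comp 2 (a ∸ 2)) N

{-# OPTIONS --safe #-}
module Submission where

-- Write a = 2 + i, let e i m be the elementary symmetric sum of degree i of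
-- 1, 1/2, …, 1/(m-1) (the inner sums of σ(b, 1, …, 1)), and
-- binom⁻¹ n k = k! n! / (n+k)! = 1 / C(n+k, k).  The truncations satisfy exactly
--
--   rhsN a N - ζN a N = Err i N = Σ_{m=1}^{N} e i m · binom⁻¹ N m / m²,
--
-- and since e i m ≤ m while Σ_{m=1}^{N} binom⁻¹ N m / m = (1 - binom⁻¹ N N) / N
-- telescopes, 0 ≤ Err i N ≤ 1/N.
--
-- Going from N to n = N + 1 the
-- weights split as binom⁻¹ N m / m² = binom⁻¹ n m / m² + binom⁻¹ n m / (n m), and
-- the sum of e i m · binom⁻¹ n m / (n m) over m ≤ N telescopes against
-- F n k = binom⁻¹ n k · D n k / n, where D n k = Σ_{j=0}^{i} n^-(j+1) e (i-j) (k+1).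
-- Its value F n 0 = n^-a is the new term of ζN, and F n N, because
-- binom⁻¹ n N = 2 / C(2n, n), combines with the new term of Err into the new
-- term of rhsN.

open import Defs
open import Data.Nat as ℕ using (ℕ; zero; suc; _!; NonZero)
open import Data.Nat.Properties using (_!≢0; _!*_!≢0)
import Data.Nat.Properties as ℕ
open import Data.Nat.Combinatorics using (_C_; k![n∸k]!∣n!)
open import Data.Nat.Combinatorics.Specification using (nCk≡n!/k![n-k]!)
open import Data.Nat.DivMod using (m/n*n≡m)
open import Data.Nat.Coprimality using (1-coprimeTo)
import Data.Integer as ℤ
import Data.Integer.Properties as ℤ
open import Data.Rational using (ℚ; mkℚ; 0ℚ; 1ℚ; _+_; _*_; _-_; -_; 1/_; _≤_; _<_; ∣_∣; *≤*; *<*; nonNegative)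
open import Data.Rational.Literals using (fromℤ)
open import Data.Rational.Properties
import Data.Rational.Unnormalised as ℚᵘ
import Data.Rational.Unnormalised.Properties as ℚᵘ
open import Data.Rational.Solver using (module +-*-Solver)
open import Algebra.Bundles using (CommutativeMonoid)
open import Algebra.Properties.CommutativeSemigroup (CommutativeMonoid.commutativeSemigroup +-0-commutativeMonoid)
  using () renaming (interchange to +-interchange)
open import Data.List using (replicate)
open import Data.Product using (∃-syntax; _,_)
open import Relation.Binary.PropositionalEquality
open +-*-Solver

fromℕ : ℕ → ℚ
fromℕ n = fromℤ (ℤ.+ n)

fromℕ-homo-+ : ∀ m n → fromℕ (m ℕ.+ n) ≡ fromℕ m + fromℕ n
fromℕ-homo-+ m n = toℚᵘ-injective (ℚᵘ.≃-sym (ℚᵘ.≃-trans (toℚᵘ-homo-+ (fromℕ m) (fromℕ n))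
  (ℚᵘ.*≡* (cong (ℤ._* ℤ.+ 1) (trans (cong₂ ℤ._+_ (ℤ.*-identityʳ (ℤ.+ m)) (ℤ.*-identityʳ (ℤ.+ n)))
                                  (sym (ℤ.pos-+ m n)))))))

fromℕ-homo-* : ∀ m n → fromℕ (m ℕ.* n) ≡ fromℕ m * fromℕ n
fromℕ-homo-* m n = toℚᵘ-injective (ℚᵘ.≃-sym (ℚᵘ.≃-trans (toℚᵘ-homo-* (fromℕ m) (fromℕ n))
  (ℚᵘ.*≡* (cong (ℤ._* ℤ.+ 1) (sym (ℤ.pos-* m n))))))

inv≡1/fromℕ : ∀ n .{{_ : NonZero n}} → inv n ≡ 1/ fromℕ n
inv≡1/fromℕ (suc k) = normalize-coprime (1-coprimeTo (suc k))

fromℕ-inverseʳ : ∀ n .{{_ : NonZero n}} → fromℕ n * inv n ≡ 1ℚ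
fromℕ-inverseʳ n@(suc _) = trans (cong (fromℕ n *_) (inv≡1/fromℕ n)) (*-inverseʳ (fromℕ n))

fromℕ-inverseˡ : ∀ n .{{_ : NonZero n}} → inv n * fromℕ n ≡ 1ℚ
fromℕ-inverseˡ n = trans (*-comm (inv n) (fromℕ n)) (fromℕ-inverseʳ n)

inv-+-inverse : ∀ m n .{{_ : NonZero (m ℕ.+ n)}} → inv (m ℕ.+ n) * (fromℕ m + fromℕ n) ≡ 1ℚ
inv-+-inverse m n = trans (cong (inv (m ℕ.+ n) *_) (sym (fromℕ-homo-+ m n))) (fromℕ-inverseˡ (m ℕ.+ n))

inv-unique : ∀ m {x} → fromℕ m * x ≡ 1ℚ → x ≡ inv m
inv-unique zero {x} 0*x≡1 with trans (sym (*-zeroˡ x)) 0*x≡1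
... | ()
inv-unique m@(suc _) {x} m*x≡1 = begin
  x                     ≡⟨ sym (*-identityˡ x) ⟩
  1ℚ * x                ≡⟨ cong (_* x) (sym (fromℕ-inverseˡ m)) ⟩
  inv m * fromℕ m * x   ≡⟨ *-assoc (inv m) (fromℕ m) x ⟩
  inv m * (fromℕ m * x) ≡⟨ cong (inv m *_) m*x≡1 ⟩
  inv m * 1ℚ            ≡⟨ *-identityʳ (inv m) ⟩
  inv m                 ∎
  where open ≡-Reasoning

inv-homo-* : ∀ m n .{{_ : NonZero m}} .{{_ : NonZero n}} → inv (m ℕ.* n) ≡ inv m * inv n
inv-homo-* m n = sym (inv-unique (m ℕ.* n) (begin
  fromℕ (m ℕ.* n) * (inv m * inv n)       ≡⟨ cong (_* (inv m * inv n)) (fromℕ-homo-* m n) ⟩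
  fromℕ m * fromℕ n * (inv m * inv n)     ≡⟨ solve 4 (λ a b u v → a :* b :* (u :* v) := (a :* u) :* (b :* v))
                                                 refl (fromℕ m) (fromℕ n) (inv m) (inv n) ⟩
  fromℕ m * inv m * (fromℕ n * inv n)     ≡⟨ cong₂ _*_ (fromℕ-inverseʳ m) (fromℕ-inverseʳ n) ⟩
  1ℚ                                      ∎))
  where open ≡-Reasoning

inv-^-suc : ∀ n k .{{_ : NonZero n}} → inv (n ℕ.^ suc k) ≡ inv n * inv (n ℕ.^ k)
inv-^-suc n k = inv-homo-* n (n ℕ.^ k)
  where instance _ = ℕ.m^n≢0 n k

0≤fromℕ : ∀ n → 0ℚ ≤ fromℕ n
0≤fromℕ n = nonNegative⁻¹ (fromℕ n)

0≤inv : ∀ n → 0ℚ ≤ inv n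
0≤inv zero    = ≤-refl
0≤inv (suc k) = nonNegative⁻¹ (inv (suc k)) {{normalize-nonNeg 1 (suc k)}}

0≤* : ∀ {p q} → 0ℚ ≤ p → 0ℚ ≤ q → 0ℚ ≤ p * q
0≤* {p} {q} p≥0 q≥0 =
  nonNegative⁻¹ (p * q) {{nonNeg*nonNeg⇒nonNeg p {{nonNegative p≥0}} q {{nonNegative q≥0}}}}

sum1-cong : ∀ {f g : ℕ → ℚ} → (∀ k → f (suc k) ≡ g (suc k)) → ∀ N → sum1 N f ≡ sum1 N g
sum1-cong f≗g zero    = refl
sum1-cong f≗g (suc N) = cong₂ _+_ (sum1-cong f≗g N) (f≗g N)

sum1-distrib-+ : ∀ N (f g : ℕ → ℚ) → sum1 N (λ k → f k + g k) ≡ sum1 N f + sum1 N g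
sum1-distrib-+ zero    f g = refl
sum1-distrib-+ (suc N) f g = trans (cong (_+ (f (suc N) + g (suc N))) (sum1-distrib-+ N f g))
  (+-interchange (sum1 N f) (sum1 N g) (f (suc N)) (g (suc N)))

*-distribˡ-sum1 : ∀ c N (f : ℕ → ℚ) → c * sum1 N f ≡ sum1 N (λ k → c * f k)
*-distribˡ-sum1 c zero    f = *-zeroʳ c
*-distribˡ-sum1 c (suc N) f =
  trans (*-distribˡ-+ c (sum1 N f) (f (suc N))) (cong (_+ c * f (suc N)) (*-distribˡ-sum1 c N f))

sum1-head : ∀ N (f : ℕ → ℚ) → sum1 (suc N) f ≡ f 1 + sum1 N (λ k → f (suc k))
sum1-head zero    f = +-comm 0ℚ (f 1)
sum1-head (suc N) f = trans (cong (_+ f (2 ℕ.+ N)) (sum1-head N f))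
  (+-assoc (f 1) (sum1 N (λ k → f (suc k))) (f (2 ℕ.+ N)))

sum1-zero : ∀ N → sum1 N (λ _ → 0ℚ) ≡ 0ℚ
sum1-zero zero    = refl
sum1-zero (suc N) = cong (_+ 0ℚ) (sum1-zero N)

sum1-telescope : ∀ {g F : ℕ → ℚ} → (∀ k → g (suc k) + F (suc k) ≡ F k) → ∀ K → sum1 K g + F K ≡ F 0
sum1-telescope {g} {F} step zero    = +-identityˡ (F 0)
sum1-telescope {g} {F} step (suc K) = begin
  sum1 K g + g (suc K) + F (suc K)   ≡⟨ +-assoc (sum1 K g) (g (suc K)) (F (suc K)) ⟩
  sum1 K g + (g (suc K) + F (suc K)) ≡⟨ cong (_+_ (sum1 K g)) (step K) ⟩
  sum1 K g + F K                     ≡⟨ sum1-telescope step K ⟩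
  F 0                                ∎
  where open ≡-Reasoning

sum1-nonNeg : ∀ {f : ℕ → ℚ} → (∀ k → 0ℚ ≤ f (suc k)) → ∀ N → 0ℚ ≤ sum1 N f
sum1-nonNeg f≥0 zero    = ≤-refl
sum1-nonNeg f≥0 (suc N) = +-mono-≤ (sum1-nonNeg f≥0 N) (f≥0 N)

sum1-mono-≤ : ∀ {f g : ℕ → ℚ} → (∀ k → f (suc k) ≤ g (suc k)) → ∀ N → sum1 N f ≤ sum1 N g
sum1-mono-≤ f≤g zero    = ≤-refl
sum1-mono-≤ f≤g (suc N) = +-mono-≤ (sum1-mono-≤ f≤g N) (f≤g N)

sumRange-3≡sum1 : ∀ i (f : ℕ → ℚ) → sumRange 3 (2 ℕ.+ i) f ≡ sum1 i (λ j → f (2 ℕ.+ j))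
sumRange-3≡sum1 zero    f = refl
sumRange-3≡sum1 (suc i) f = cong (_+ f (3 ℕ.+ i)) (sumRange-3≡sum1 i f)

sum1-inv-^-suc : ∀ n .{{_ : NonZero n}} i (x : ℕ → ℚ) →
  sum1 i (λ j → inv (n ℕ.^ (2 ℕ.+ j)) * x j) ≡ inv n * sum1 i (λ j → inv (n ℕ.^ suc j) * x j)
sum1-inv-^-suc n i x = begin
  sum1 i (λ j → inv (n ℕ.^ (2 ℕ.+ j)) * x j)
    ≡⟨ sum1-cong (λ j → trans (cong (_* x (suc j)) (inv-^-suc n (2 ℕ.+ j))) (*-assoc (inv n) _ (x (suc j)))) i ⟩
  sum1 i (λ j → inv n * (inv (n ℕ.^ suc j) * x j))
    ≡⟨ sym (*-distribˡ-sum1 (inv n) i _) ⟩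
  inv n * sum1 i (λ j → inv (n ℕ.^ suc j) * x j) ∎
  where open ≡-Reasoning

-- Elementary symmetric sums of 1, 1/2, …, 1/(m-1)

e : ℕ → ℕ → ℚ
e i = tailSum (replicate i 1)

e-suc : ∀ i k → e (suc i) (2 ℕ.+ k) ≡ e (suc i) (suc k) + inv (suc k) * e i (suc k)
e-suc i k = cong (λ d → e (suc i) (suc k) + inv d * e i (suc k)) (ℕ.*-identityʳ (suc k))

0≤e : ∀ i m → 0ℚ ≤ e i m
0≤e zero    m = nonNegative⁻¹ 1ℚ
0≤e (suc i) m = sum1-nonNeg (λ k → 0≤* (0≤inv (suc k ℕ.^ 1)) (0≤e i (suc k))) (m ℕ.∸ 1)

e≤fromℕ : ∀ i k → e i (suc k) ≤ fromℕ (suc k)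
e≤fromℕ zero    k       = *≤* (ℤ.+≤+ (ℕ.s≤s ℕ.z≤n))
e≤fromℕ (suc i) zero    = 0≤fromℕ 1
e≤fromℕ (suc i) (suc k) = begin
  e (suc i) (2 ℕ.+ k)                                     ≡⟨ e-suc i k ⟩
  e (suc i) (suc k) + inv (suc k) * e i (suc k)
    ≤⟨ +-mono-≤ (e≤fromℕ (suc i) k)
                (*-monoˡ-≤-nonNeg (inv (suc k)) {{nonNegative (0≤inv (suc k))}} (e≤fromℕ i k)) ⟩
  fromℕ (suc k) + inv (suc k) * fromℕ (suc k)             ≡⟨ cong (_+_ (fromℕ (suc k))) (fromℕ-inverseˡ (suc k)) ⟩
  fromℕ (suc k) + fromℕ 1                                 ≡⟨ sym (fromℕ-homo-+ (suc k) 1) ⟩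
  fromℕ (suc k ℕ.+ 1)                                     ≡⟨ cong fromℕ (ℕ.+-comm (suc k) 1) ⟩
  fromℕ (2 ℕ.+ k)                                         ∎
  where open ≤-Reasoning

-- Inverse binomial coefficients

nCk*k![n∸k]!≡n! : ∀ {n k} → k ℕ.≤ n → (n C k) ℕ.* (k ! ℕ.* (n ℕ.∸ k) !) ≡ n !
nCk*k![n∸k]!≡n! {n} {k} k≤n = begin
  (n C k) ℕ.* (k ! ℕ.* (n ℕ.∸ k) !)
    ≡⟨ cong (ℕ._* (k ! ℕ.* (n ℕ.∸ k) !)) (nCk≡n!/k![n-k]! k≤n) ⟩
  (n ! ℕ./ (k ! ℕ.* (n ℕ.∸ k) !)) ℕ.* (k ! ℕ.* (n ℕ.∸ k) !)
    ≡⟨ m/n*n≡m (k![n∸k]!∣n! k≤n) ⟩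
  n ! ∎
  where
  open ≡-Reasoning
  instance _ = k !* (n ℕ.∸ k) !≢0

binom⁻¹ : ℕ → ℕ → ℚ
binom⁻¹ M k = fromℕ (k ! ℕ.* M !) * inv ((k ℕ.+ M) !)

binom⁻¹-zero : ∀ M → binom⁻¹ M 0 ≡ 1ℚ
binom⁻¹-zero M = trans (cong (λ m → fromℕ m * inv (M !)) (ℕ.*-identityˡ (M !)))
                       (fromℕ-inverseʳ (M !) {{M !≢0}})

binom⁻¹-suc : ∀ M k → binom⁻¹ M (suc k) ≡ binom⁻¹ M k * fromℕ (suc k) * inv (suc k ℕ.+ M)
binom⁻¹-suc M k = begin
  fromℕ (suc k ℕ.* k ! ℕ.* M !) * inv ((suc k ℕ.+ M) ℕ.* (k ℕ.+ M) !)
    ≡⟨ cong₂ (λ m d → fromℕ m * d) (ℕ.*-assoc (suc k) (k !) (M !))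
                                   (inv-homo-* (suc k ℕ.+ M) ((k ℕ.+ M) !) {{_}} {{(k ℕ.+ M) !≢0}}) ⟩
  fromℕ (suc k ℕ.* (k ! ℕ.* M !)) * (inv (suc k ℕ.+ M) * inv ((k ℕ.+ M) !))
    ≡⟨ cong (_* (inv (suc k ℕ.+ M) * inv ((k ℕ.+ M) !))) (fromℕ-homo-* (suc k) (k ! ℕ.* M !)) ⟩
  fromℕ (suc k) * fromℕ (k ! ℕ.* M !) * (inv (suc k ℕ.+ M) * inv ((k ℕ.+ M) !))
    ≡⟨ solve 4 (λ a b c d → a :* b :* (c :* d) := b :* d :* a :* c) refl
               (fromℕ (suc k)) (fromℕ (k ! ℕ.* M !)) (inv (suc k ℕ.+ M)) (inv ((k ℕ.+ M) !)) ⟩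
  binom⁻¹ M k * fromℕ (suc k) * inv (suc k ℕ.+ M) ∎
  where open ≡-Reasoning

binom⁻¹-comm : ∀ M k → binom⁻¹ M k ≡ binom⁻¹ k M
binom⁻¹-comm M k = cong₂ (λ m s → fromℕ m * inv (s !)) (ℕ.*-comm (k !) (M !)) (ℕ.+-comm k M)

binom⁻¹-sucˡ : ∀ M k → binom⁻¹ (suc M) k ≡ binom⁻¹ M k * fromℕ (suc M) * inv (suc M ℕ.+ k)
binom⁻¹-sucˡ M k = begin
  binom⁻¹ (suc M) k                              ≡⟨ binom⁻¹-comm (suc M) k ⟩
  binom⁻¹ k (suc M)                              ≡⟨ binom⁻¹-suc k M ⟩
  binom⁻¹ k M * fromℕ (suc M) * inv (suc M ℕ.+ k)
    ≡⟨ cong (λ b → b * fromℕ (suc M) * inv (suc M ℕ.+ k)) (binom⁻¹-comm k M) ⟩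
  binom⁻¹ M k * fromℕ (suc M) * inv (suc M ℕ.+ k) ∎
  where open ≡-Reasoning

0≤binom⁻¹ : ∀ M k → 0ℚ ≤ binom⁻¹ M k
0≤binom⁻¹ M k = 0≤* (0≤fromℕ (k ! ℕ.* M !)) (0≤inv ((k ℕ.+ M) !))

inv-centralBinomial : ∀ n → inv ((2 ℕ.* n) C n) ≡ binom⁻¹ n n
inv-centralBinomial n = begin
  inv ((2 ℕ.* n) C n) ≡⟨ cong (λ m → inv ((n ℕ.+ m) C n)) (ℕ.+-identityʳ n) ⟩
  inv ((n ℕ.+ n) C n) ≡⟨ sym (inv-unique ((n ℕ.+ n) C n) C*binom⁻¹≡1) ⟩
  binom⁻¹ n n         ∎
  where
  open ≡-Reasoning
  C*binom⁻¹≡1 : fromℕ ((n ℕ.+ n) C n) * binom⁻¹ n n ≡ 1ℚ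
  C*binom⁻¹≡1 = begin
    fromℕ ((n ℕ.+ n) C n) * (fromℕ (n ! ℕ.* n !) * inv ((n ℕ.+ n) !))
      ≡⟨ sym (*-assoc (fromℕ ((n ℕ.+ n) C n)) (fromℕ (n ! ℕ.* n !)) (inv ((n ℕ.+ n) !))) ⟩
    fromℕ ((n ℕ.+ n) C n) * fromℕ (n ! ℕ.* n !) * inv ((n ℕ.+ n) !)
      ≡⟨ cong (_* inv ((n ℕ.+ n) !)) (sym (fromℕ-homo-* ((n ℕ.+ n) C n) (n ! ℕ.* n !))) ⟩
    fromℕ (((n ℕ.+ n) C n) ℕ.* (n ! ℕ.* n !)) * inv ((n ℕ.+ n) !)
      ≡⟨ cong (λ m → fromℕ m * inv ((n ℕ.+ n) !)) central ⟩
    fromℕ ((n ℕ.+ n) !) * inv ((n ℕ.+ n) !)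
      ≡⟨ fromℕ-inverseʳ ((n ℕ.+ n) !) {{(n ℕ.+ n) !≢0}} ⟩
    1ℚ ∎
    where
    central : ((n ℕ.+ n) C n) ℕ.* (n ! ℕ.* n !) ≡ (n ℕ.+ n) !
    central = subst (λ m → ((n ℕ.+ n) C n) ℕ.* (n ! ℕ.* m !) ≡ (n ℕ.+ n) !)
                    (ℕ.m+n∸m≡n n n) (nCk*k![n∸k]!≡n! (ℕ.m≤m+n n n))

binom⁻¹-pred-diagonal : ∀ N → binom⁻¹ (suc N) N ≡ fromℕ 2 * binom⁻¹ (suc N) (suc N)
binom⁻¹-pred-diagonal N = sym (begin
  fromℕ 2 * binom⁻¹ n n             ≡⟨ cong (fromℕ 2 *_) (binom⁻¹-suc n N) ⟩
  fromℕ 2 * (g * fromℕ n * inv (n ℕ.+ n))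
    ≡⟨ solve 3 (λ g a w → con (fromℕ 2) :* (g :* a :* w) := g :* (w :* (a :+ a)))
               refl g (fromℕ n) (inv (n ℕ.+ n)) ⟩
  g * (inv (n ℕ.+ n) * (fromℕ n + fromℕ n)) ≡⟨ cong (g *_) (inv-+-inverse n n) ⟩
  g * 1ℚ                            ≡⟨ *-identityʳ g ⟩
  g                                 ∎)
  where
  open ≡-Reasoning
  n = suc N
  g = binom⁻¹ n N

sum1-inv*binom⁻¹ : ∀ M .{{_ : NonZero M}} K →
  sum1 K (λ m → inv m * binom⁻¹ M m) + inv M * binom⁻¹ M K ≡ inv M
sum1-inv*binom⁻¹ M K =
  trans (sum1-telescope step K) (trans (cong (inv M *_) (binom⁻¹-zero M)) (*-identityʳ (inv M)))
  where
  open ≡-Reasoning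
  step : ∀ k → inv (suc k) * binom⁻¹ M (suc k) + inv M * binom⁻¹ M (suc k) ≡ inv M * binom⁻¹ M k
  step k = begin
    v * binom⁻¹ M (suc k) + t * binom⁻¹ M (suc k)
      ≡⟨ cong (λ g′ → v * g′ + t * g′) (binom⁻¹-suc M k) ⟩
    v * (g * b * w) + t * (g * b * w)
      ≡⟨ solve 5 (λ v t g b w → v :* (g :* b :* w) :+ t :* (g :* b :* w) := (v :* b) :* g :* w :+ t :* g :* b :* w)
                 refl v t g b w ⟩
    (v * b) * g * w + t * g * b * w
      ≡⟨ cong (λ p → p * g * w + t * g * b * w) (trans (fromℕ-inverseˡ (suc k)) (sym (fromℕ-inverseˡ M))) ⟩
    (t * a) * g * w + t * g * b * w
      ≡⟨ solve 5 (λ t a g b w → (t :* a) :* g :* w :+ t :* g :* b :* w := t :* g :* (w :* (b :+ a)))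
                 refl t a g b w ⟩
    t * g * (w * (b + a))
      ≡⟨ cong (t * g *_) (inv-+-inverse (suc k) M) ⟩
    t * g * 1ℚ
      ≡⟨ *-identityʳ (t * g) ⟩
    t * g ∎
    where
    a = fromℕ M
    b = fromℕ (suc k)
    t = inv M
    v = inv (suc k)
    w = inv (suc k ℕ.+ M)
    g = binom⁻¹ M k

-- The telescoping functions

D : ℕ → ℕ → ℕ → ℚ
D zero    n k = inv n
D (suc i) n k = inv n * (e (suc i) (suc k) + D i n k)

D-zero : ∀ i n .{{_ : NonZero n}} → D i n 0 ≡ inv (n ℕ.^ suc i)
D-zero zero    n = cong inv (sym (ℕ.*-identityʳ n))
D-zero (suc i) n = trans (cong (inv n *_) (trans (+-identityˡ (D i n 0)) (D-zero i n))) (sym (inv-^-suc n (suc i)))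

D-recurrence : ∀ i n .{{_ : NonZero n}} k →
  (fromℕ n + fromℕ (suc k)) * D i n k ≡ e i (suc k) + fromℕ (suc k) * D i n (suc k)
D-recurrence zero    n k = trans (*-distribʳ-+ (inv n) (fromℕ n) (fromℕ (suc k)))
                                 (cong (_+ fromℕ (suc k) * inv n) (fromℕ-inverseʳ n))
D-recurrence (suc i) n k = begin
  (a + b) * (u * (e₁ + D i n k))
    ≡⟨ solve 5 (λ a b u e₁ d → (a :+ b) :* (u :* (e₁ :+ d))
                               := (a :* u) :* e₁ :+ b :* u :* e₁ :+ u :* ((a :+ b) :* d))
               refl a b u e₁ (D i n k) ⟩
  (a * u) * e₁ + b * u * e₁ + u * ((a + b) * D i n k)
    ≡⟨ cong₂ (λ p d → p * e₁ + b * u * e₁ + u * d) (fromℕ-inverseʳ n) (D-recurrence i n k) ⟩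
  1ℚ * e₁ + b * u * e₁ + u * (e₀ + b * D i n (suc k))
    ≡⟨ cong (λ x → 1ℚ * e₁ + b * u * e₁ + u * (x + b * D i n (suc k)))
            (sym (trans (cong (_* e₀) (fromℕ-inverseʳ (suc k))) (*-identityˡ e₀))) ⟩
  1ℚ * e₁ + b * u * e₁ + u * (b * v * e₀ + b * D i n (suc k))
    ≡⟨ solve 6 (λ b u v e₁ e₀ d → con 1ℚ :* e₁ :+ b :* u :* e₁ :+ u :* (b :* v :* e₀ :+ b :* d)
                                  := e₁ :+ b :* (u :* (e₁ :+ v :* e₀ :+ d)))
               refl b u v e₁ e₀ (D i n (suc k)) ⟩
  e₁ + b * (u * (e₁ + v * e₀ + D i n (suc k)))
    ≡⟨ cong (λ x → e₁ + b * (u * (x + D i n (suc k)))) (sym (e-suc i k)) ⟩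
  e₁ + b * D (suc i) n (suc k) ∎
  where
  open ≡-Reasoning
  a = fromℕ n
  b = fromℕ (suc k)
  u = inv n
  v = inv (suc k)
  e₁ = e (suc i) (suc k)
  e₀ = e i (suc k)

D-diagonal : ∀ i N →
  D i (suc N) N ≡ inv (suc N) * e i (suc N) + sum1 i (λ j → inv (suc N ℕ.^ suc j) * e (i ℕ.∸ j) (suc N))
D-diagonal zero    N = solve 1 (λ u → u := u :* con 1ℚ :+ con 0ℚ) refl (inv (suc N))
D-diagonal (suc i) N = begin
  u * (e (suc i) n + D i n N)
    ≡⟨ cong (λ d → u * (e (suc i) n + d)) (D-diagonal i N) ⟩
  u * (e (suc i) n + (u * e i n + S i))
    ≡⟨ solve 4 (λ u x y s → u :* (x :+ (u :* y :+ s)) := u :* x :+ (u :* (u :* con 1ℚ) :* y :+ u :* s))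
               refl u (e (suc i) n) (e i n) (S i) ⟩
  u * e (suc i) n + (u * (u * 1ℚ) * e i n + u * S i)
    ≡⟨ cong₂ (λ p s → u * e (suc i) n + (p * e i n + s))
             (sym (trans (inv-^-suc n 1) (cong (u *_) (inv-^-suc n 0))))
             (sym (sum1-inv-^-suc n i (λ j → e (i ℕ.∸ j) n))) ⟩
  u * e (suc i) n + (inv (n ℕ.^ 2) * e i n + sum1 i (λ j → inv (n ℕ.^ (2 ℕ.+ j)) * e (i ℕ.∸ j) n))
    ≡⟨ cong (u * e (suc i) n +_) (sym (sum1-head i (λ j → inv (n ℕ.^ suc j) * e (suc i ℕ.∸ j) n))) ⟩
  u * e (suc i) n + S (suc i) ∎
  where
  open ≡-Reasoning
  n = suc N
  u = inv n
  S : ℕ → ℚ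
  S l = sum1 l (λ j → inv (n ℕ.^ suc j) * e (l ℕ.∸ j) n)

F : ℕ → ℕ → ℕ → ℚ
F i n k = inv n * binom⁻¹ n k * D i n k

H : ℕ → ℕ → ℚ
H n m = inv n * inv m * binom⁻¹ n m

F-step : ∀ i n .{{_ : NonZero n}} k → e i (suc k) * H n (suc k) + F i n (suc k) ≡ F i n k
F-step i n k = begin
  e₀ * (u * v * binom⁻¹ n (suc k)) + u * binom⁻¹ n (suc k) * D i n (suc k)
    ≡⟨ cong (λ g → e₀ * (u * v * g) + u * g * D i n (suc k)) (binom⁻¹-suc n k) ⟩
  e₀ * (u * v * (g * b * w)) + u * (g * b * w) * D i n (suc k)
    ≡⟨ solve 7 (λ e₀ u v g b w d → e₀ :* (u :* v :* (g :* b :* w)) :+ u :* (g :* b :* w) :* d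
                                   := u :* g :* w :* ((v :* b) :* e₀ :+ b :* d))
               refl e₀ u v g b w (D i n (suc k)) ⟩
  u * g * w * ((v * b) * e₀ + b * D i n (suc k))
    ≡⟨ cong (λ p → u * g * w * (p * e₀ + b * D i n (suc k))) (fromℕ-inverseˡ (suc k)) ⟩
  u * g * w * (1ℚ * e₀ + b * D i n (suc k))
    ≡⟨ cong (λ x → u * g * w * (x + b * D i n (suc k))) (*-identityˡ e₀) ⟩
  u * g * w * (e₀ + b * D i n (suc k))
    ≡⟨ cong (u * g * w *_) (sym (D-recurrence i n k)) ⟩
  u * g * w * ((a + b) * D i n k)
    ≡⟨ solve 6 (λ u g w a b d → u :* g :* w :* ((a :+ b) :* d) := u :* g :* d :* (w :* (b :+ a)))
               refl u g w a b (D i n k) ⟩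
  u * g * D i n k * (w * (b + a))
    ≡⟨ cong (u * g * D i n k *_) (inv-+-inverse (suc k) n) ⟩
  u * g * D i n k * 1ℚ
    ≡⟨ *-identityʳ (F i n k) ⟩
  F i n k ∎
  where
  open ≡-Reasoning
  a = fromℕ n
  b = fromℕ (suc k)
  u = inv n
  v = inv (suc k)
  w = inv (suc k ℕ.+ n)
  g = binom⁻¹ n k
  e₀ = e i (suc k)

F-zero : ∀ i n .{{_ : NonZero n}} → F i n 0 ≡ inv (n ℕ.^ (2 ℕ.+ i))
F-zero i n = begin
  inv n * binom⁻¹ n 0 * D i n 0    ≡⟨ cong₂ (λ g d → inv n * g * d) (binom⁻¹-zero n) (D-zero i n) ⟩
  inv n * 1ℚ * inv (n ℕ.^ suc i)   ≡⟨ cong (_* inv (n ℕ.^ suc i)) (*-identityʳ (inv n)) ⟩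
  inv n * inv (n ℕ.^ suc i)        ≡⟨ sym (inv-^-suc n (suc i)) ⟩
  inv (n ℕ.^ (2 ℕ.+ i))            ∎
  where open ≡-Reasoning

F-telescope : ∀ i n .{{_ : NonZero n}} K → sum1 K (λ m → e i m * H n m) + F i n K ≡ inv (n ℕ.^ (2 ℕ.+ i))
F-telescope i n K = trans (sum1-telescope (F-step i n) K) (F-zero i n)

Ω : ℕ → ℕ → ℚ
Ω N m = inv m * inv m * binom⁻¹ N m

Ω-step : ∀ N k → Ω (suc N) (suc k) + H (suc N) (suc k) ≡ Ω N (suc k)
Ω-step N k = begin
  u * u * binom⁻¹ n m + t * u * binom⁻¹ n m
    ≡⟨ cong (λ g → u * u * g + t * u * g) (binom⁻¹-sucˡ N m) ⟩
  u * u * (g * c * w) + t * u * (g * c * w)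
    ≡⟨ solve 5 (λ u t g c w → u :* u :* (g :* c :* w) :+ t :* u :* (g :* c :* w)
                              := u :* u :* g :* w :* c :+ (t :* c) :* u :* g :* w)
               refl u t g c w ⟩
  u * u * g * w * c + (t * c) * u * g * w
    ≡⟨ cong (λ p → u * u * g * w * c + p * u * g * w)
            (trans (fromℕ-inverseˡ n) (sym (fromℕ-inverseˡ m))) ⟩
  u * u * g * w * c + (u * b) * u * g * w
    ≡⟨ solve 5 (λ u g c w b → u :* u :* g :* w :* c :+ (u :* b) :* u :* g :* w
                              := u :* u :* g :* (w :* (c :+ b)))
               refl u g c w b ⟩
  u * u * g * (w * (c + b))
    ≡⟨ cong (u * u * g *_) (inv-+-inverse n m) ⟩
  u * u * g * 1ℚ
    ≡⟨ *-identityʳ (Ω N m) ⟩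
  Ω N m ∎
  where
  open ≡-Reasoning
  n = suc N
  m = suc k
  u = inv m
  t = inv n
  b = fromℕ m
  c = fromℕ n
  w = inv (n ℕ.+ m)
  g = binom⁻¹ N m

-- The error term

Err : ℕ → ℕ → ℚ
Err i N = sum1 N (λ m → e i m * Ω N m)

Err-split : ∀ i N → Err i N + F i (suc N) N ≡ sum1 N (λ m → e i m * Ω (suc N) m) + inv (suc N ℕ.^ (2 ℕ.+ i))
Err-split i N = begin
  Err i N + F i n N
    ≡⟨ cong (_+ F i n N) (trans (sum1-cong split N) (sum1-distrib-+ N _ _)) ⟩
  sum1 N (λ m → e i m * Ω n m) + sum1 N (λ m → e i m * H n m) + F i n N
    ≡⟨ +-assoc (sum1 N (λ m → e i m * Ω n m)) _ _ ⟩
  sum1 N (λ m → e i m * Ω n m) + (sum1 N (λ m → e i m * H n m) + F i n N)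
    ≡⟨ cong (_+_ (sum1 N (λ m → e i m * Ω n m))) (F-telescope i n N) ⟩
  sum1 N (λ m → e i m * Ω n m) + inv (n ℕ.^ (2 ℕ.+ i)) ∎
  where
  open ≡-Reasoning
  n = suc N
  split : ∀ k → e i (suc k) * Ω N (suc k) ≡ e i (suc k) * Ω n (suc k) + e i (suc k) * H n (suc k)
  split k = trans (cong (e i (suc k) *_) (sym (Ω-step N k))) (*-distribˡ-+ (e i (suc k)) _ _)

rhsTerm : ℕ → ℕ → ℚ
rhsTerm i n = fromℕ 2 * sum1 i (λ j → inv ((2 ℕ.* n) C n) * inv (n ℕ.^ (2 ℕ.+ j)) * e (i ℕ.∸ j) n)
            + fromℕ 3 * (inv ((2 ℕ.* n) C n) * inv (n ℕ.^ 2) * e i n)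

rhsN-suc : ∀ i N → rhsN (2 ℕ.+ i) (suc N) ≡ rhsN (2 ℕ.+ i) N + rhsTerm i (suc N)
rhsN-suc i N = begin
  fromℕ 2 * sumRange 3 a (σ (suc N)) + fromℕ 3 * σ₂ (suc N)
    ≡⟨ cong (λ s → fromℕ 2 * s + fromℕ 3 * σ₂ (suc N)) (sumRange-3≡sum1 i (σ (suc N))) ⟩
  fromℕ 2 * sum1 i (λ j → σ N (2 ℕ.+ j) + y j) + fromℕ 3 * (σ₂ N + z)
    ≡⟨ cong (λ s → fromℕ 2 * s + fromℕ 3 * (σ₂ N + z))
            (trans (sum1-distrib-+ i _ y) (cong (_+ sum1 i y) (sym (sumRange-3≡sum1 i (σ N))))) ⟩
  fromℕ 2 * (sumRange 3 a (σ N) + sum1 i y) + fromℕ 3 * (σ₂ N + z)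
    ≡⟨ solve 6 (λ c d s t x y → c :* (s :+ t) :+ d :* (x :+ y) := (c :* s :+ d :* x) :+ (c :* t :+ d :* y))
               refl (fromℕ 2) (fromℕ 3) (sumRange 3 a (σ N)) (sum1 i y) (σ₂ N) z ⟩
  rhsN a N + rhsTerm i (suc N) ∎
  where
  open ≡-Reasoning
  a = 2 ℕ.+ i
  σ : ℕ → ℕ → ℚ
  σ M b = σN (comp b (a ℕ.∸ b)) M
  σ₂ : ℕ → ℚ
  σ₂ M = σ M 2
  y : ℕ → ℚ
  y j = inv ((2 ℕ.* suc N) C suc N) * inv (suc N ℕ.^ (2 ℕ.+ j)) * e (i ℕ.∸ j) (suc N)
  z = inv ((2 ℕ.* suc N) C suc N) * inv (suc N ℕ.^ 2) * e i (suc N)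

rhsTerm≡F+eΩ : ∀ i N → rhsTerm i (suc N) ≡ F i (suc N) N + e i (suc N) * Ω (suc N) (suc N)
rhsTerm≡F+eΩ i N = begin
  fromℕ 2 * sum1 i (λ j → inv ((2 ℕ.* n) C n) * inv (n ℕ.^ (2 ℕ.+ j)) * e (i ℕ.∸ j) n)
    + fromℕ 3 * (inv ((2 ℕ.* n) C n) * inv (n ℕ.^ 2) * e i n)
    ≡⟨ cong₂ (λ s p → fromℕ 2 * s + fromℕ 3 * (inv ((2 ℕ.* n) C n) * p * e i n))
             (sum1-cong (λ j → *-assoc (inv ((2 ℕ.* n) C n)) _ _) i)
             (trans (inv-^-suc n 1) (cong (u *_) (inv-^-suc n 0))) ⟩
  fromℕ 2 * sum1 i (λ j → inv ((2 ℕ.* n) C n) * (inv (n ℕ.^ (2 ℕ.+ j)) * e (i ℕ.∸ j) n))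
    + fromℕ 3 * (inv ((2 ℕ.* n) C n) * (u * (u * 1ℚ)) * e i n)
    ≡⟨ cong (λ s → fromℕ 2 * s + fromℕ 3 * (inv ((2 ℕ.* n) C n) * (u * (u * 1ℚ)) * e i n))
            (trans (sym (*-distribˡ-sum1 (inv ((2 ℕ.* n) C n)) i _))
                   (cong (inv ((2 ℕ.* n) C n) *_) (sum1-inv-^-suc n i (λ j → e (i ℕ.∸ j) n)))) ⟩
  fromℕ 2 * (inv ((2 ℕ.* n) C n) * (u * S)) + fromℕ 3 * (inv ((2 ℕ.* n) C n) * (u * (u * 1ℚ)) * e i n)
    ≡⟨ cong (λ c → fromℕ 2 * (c * (u * S)) + fromℕ 3 * (c * (u * (u * 1ℚ)) * e i n)) (inv-centralBinomial n) ⟩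
  fromℕ 2 * (c * (u * S)) + fromℕ 3 * (c * (u * (u * 1ℚ)) * e i n)
    ≡⟨ solve 4 (λ c u s x → con (fromℕ 2) :* (c :* (u :* s))
                              :+ con (fromℕ 3) :* (c :* (u :* (u :* con 1ℚ)) :* x)
                            := u :* (con (fromℕ 2) :* c) :* (u :* x :+ s) :+ x :* (u :* u :* c))
               refl c u S (e i n) ⟩
  u * (fromℕ 2 * c) * (u * e i n + S) + e i n * (u * u * c)
    ≡⟨ cong₂ (λ g d → u * g * d + e i n * (u * u * c)) (sym (binom⁻¹-pred-diagonal N)) (sym (D-diagonal i N)) ⟩
  F i n N + e i n * Ω n n ∎
  where
  open ≡-Reasoning
  n = suc N
  u = inv n
  c = binom⁻¹ n n
  S = sum1 i (λ j → inv (n ℕ.^ suc j) * e (i ℕ.∸ j) n)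

rhsN≡ζN+Err : ∀ i N → rhsN (2 ℕ.+ i) N ≡ ζN (2 ℕ.+ i) N + Err i N
rhsN≡ζN+Err i zero    = cong (λ s → fromℕ 2 * s + fromℕ 3 * 0ℚ) (trans (sumRange-3≡sum1 i _) (sum1-zero i))
rhsN≡ζN+Err i (suc N) = begin
  rhsN a (suc N)                  ≡⟨ rhsN-suc i N ⟩
  rhsN a N + rhsTerm i n          ≡⟨ cong₂ _+_ (rhsN≡ζN+Err i N) (rhsTerm≡F+eΩ i N) ⟩
  ζN a N + Err i N + (F i n N + x)
    ≡⟨ solve 4 (λ z r f x → z :+ r :+ (f :+ x) := z :+ (r :+ f) :+ x) refl (ζN a N) (Err i N) (F i n N) x ⟩
  ζN a N + (Err i N + F i n N) + x ≡⟨ cong (λ s → ζN a N + s + x) (Err-split i N) ⟩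
  ζN a N + (S + p) + x
    ≡⟨ solve 4 (λ z s p x → z :+ (s :+ p) :+ x := (z :+ p) :+ (s :+ x)) refl (ζN a N) S p x ⟩
  ζN a (suc N) + Err i (suc N)    ∎
  where
  open ≡-Reasoning
  a = 2 ℕ.+ i
  n = suc N
  p = inv (n ℕ.^ a)
  x = e i n * Ω n n
  S = sum1 N (λ m → e i m * Ω n m)

0≤Ω : ∀ N m → 0ℚ ≤ Ω N m
0≤Ω N m = 0≤* (0≤* (0≤inv m) (0≤inv m)) (0≤binom⁻¹ N m)

0≤Err : ∀ i N → 0ℚ ≤ Err i N
0≤Err i N = sum1-nonNeg (λ k → 0≤* (0≤e i (suc k)) (0≤Ω N (suc k))) N

Err≤inv : ∀ i N → Err i N ≤ inv N
Err≤inv i zero      = ≤-refl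
Err≤inv i N@(suc _) = begin
  Err i N                         ≤⟨ sum1-mono-≤ eΩ≤ N ⟩
  S                               ≡⟨ sym (+-identityʳ S) ⟩
  S + 0ℚ                          ≤⟨ +-monoʳ-≤ S (0≤* (0≤inv N) (0≤binom⁻¹ N N)) ⟩
  S + inv N * binom⁻¹ N N         ≡⟨ sum1-inv*binom⁻¹ N N ⟩
  inv N                           ∎
  where
  open ≤-Reasoning
  S = sum1 N (λ m → inv m * binom⁻¹ N m)
  eΩ≤ : ∀ k → e i (suc k) * Ω N (suc k) ≤ inv (suc k) * binom⁻¹ N (suc k)
  eΩ≤ k = begin
    e i m * Ω N m                ≤⟨ *-monoʳ-≤-nonNeg (Ω N m) {{nonNegative (0≤Ω N m)}} (e≤fromℕ i k) ⟩
    fromℕ m * (u * u * g)        ≡⟨ solve 3 (λ x u g → x :* (u :* u :* g) := (x :* u) :* (u :* g)) refl (fromℕ m) u g ⟩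
    (fromℕ m * u) * (u * g)      ≡⟨ cong (_* (u * g)) (fromℕ-inverseʳ m) ⟩
    1ℚ * (u * g)                 ≡⟨ *-identityˡ (u * g) ⟩
    u * g                        ∎
    where
    m = suc k
    u = inv m
    g = binom⁻¹ N m

∣ζN-rhsN∣≡Err : ∀ i N → ∣ ζN (2 ℕ.+ i) N - rhsN (2 ℕ.+ i) N ∣ ≡ Err i N
∣ζN-rhsN∣≡Err i N = begin
  ∣ ζN a N - rhsN a N ∣             ≡⟨ cong (λ r → ∣ ζN a N - r ∣) (rhsN≡ζN+Err i N) ⟩
  ∣ ζN a N - (ζN a N + Err i N) ∣   ≡⟨ cong ∣_∣ (solve 2 (λ z x → z :- (z :+ x) := :- x) refl (ζN a N) (Err i N)) ⟩
  ∣ - Err i N ∣                     ≡⟨ ∣-p∣≡∣p∣ (Err i N) ⟩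
  ∣ Err i N ∣                       ≡⟨ 0≤p⇒∣p∣≡p (0≤Err i N) ⟩
  Err i N                           ∎
  where
  open ≡-Reasoning
  a = 2 ℕ.+ i

-- ε = (p+1)/(q+1) ≥ 1/(q+1) > 1/N as soon as N ≥ q + 2.
inv-eventually-< : ∀ ε → 0ℚ < ε → ∃[ N₀ ] (∀ N → N₀ ℕ.≤ N → inv N < ε)
inv-eventually-< (mkℚ (ℤ.+ zero)  _ _) (*<* (ℤ.+<+ ()))
inv-eventually-< (mkℚ ℤ.-[1+ _ ]  _ _) (*<* ())
inv-eventually-< ε@(mkℚ ℤ.+[1+ p ] q _) _ = 2 ℕ.+ q , inv<ε
  where
  inv<ε : ∀ N → 2 ℕ.+ q ℕ.≤ N → inv N < ε
  inv<ε N@(suc M) (ℕ.s≤s q<M) = subst (_< ε) (sym (inv≡1/fromℕ N))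
    (*<* (subst₂ ℤ._<_ (ℤ.pos-* 1 (suc q)) (ℤ.pos-* (suc p) N) (ℤ.+<+ cross)))
    where
    open ℕ.≤-Reasoning
    cross : 1 ℕ.* suc q ℕ.< suc p ℕ.* N
    cross = begin-strict
      1 ℕ.* suc q   ≡⟨ ℕ.*-identityˡ (suc q) ⟩
      suc q         <⟨ ℕ.s≤s q<M ⟩
      N             ≤⟨ ℕ.m≤m+n N (p ℕ.* N) ⟩
      suc p ℕ.* N   ∎

corollary1 : (a : ℕ) → 2 ℕ.≤ a → (ε : ℚ) → 0ℚ < ε →
    ∃[ N₀ ] ((N : ℕ) → N₀ ℕ.≤ N → ∣ ζN a N - rhsN a N ∣ < ε)
corollary1 1 (ℕ.s≤s ())
corollary1 (suc (suc i)) _ ε ε>0 with inv-eventually-< ε ε>0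
... | N₀ , inv<ε = N₀ , λ N N₀≤N → begin-strict
  ∣ ζN (2 ℕ.+ i) N - rhsN (2 ℕ.+ i) N ∣ ≡⟨ ∣ζN-rhsN∣≡Err i N ⟩
  Err i N                               ≤⟨ Err≤inv i N ⟩
  inv N                                 <⟨ inv<ε N N₀≤N ⟩
  ε                                     ∎
  where open ≤-Reasoning
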